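{- For $x\in\mathrm{Tam}(B_n)$, $\mathrm{half}(\mathrm{rev}(x))=\mathrm{rev}(\mathrm{half}(x))$.
   Context: $B_n$ is the set of permutations $x=x_1\cdots x_{2n}$ of $\{1,\dots,2n\}$ with $x_i+x_{2n+1-i}=2n+1$ for all $i$. $x\in B_n$ contains a $312^*$ pattern if there are $i<j<k$ with $x_j<x_k<x_i$ and $x_k\ge n+1$; $\mathrm{Tam}(B_n)$ is the set of $312^*$-avoiding elements of $B_n$. For a word $w$ of distinct integers, $\mathrm{rev}(w)$ is obtained by reversing each maximal descending run (maximal consecutive decreasing substring) of $w$. $\mathrm{half}(x)$ is the subsequence of $x$ consisting of all entries that are at least $n+1$ (in the order they appear in $x$). -}

module Defs where

open import Data.Nat using (ℕ; zero; suc; _+_; _*_; _<_; _≤_; _<ᵇ_)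
open import Data.Bool using (Bool; true; false; if_then_else_)
open import Data.List using (List; []; _∷_; _++_; length; reverse; map; concat; filterᵇ; lookup; zipWith; applyUpTo)
open import Data.List.Relation.Binary.Permutation.Propositional using (_↭_)
open import Data.List.Relation.Unary.All using (All)
open import Data.Fin using (Fin; toℕ)
open import Data.Product using (_×_; ∃-syntax)
open import Relation.Binary.PropositionalEquality using (_≡_)
open import Relation.Nullary using (¬_)

oneTo : ℕ → List ℕ
oneTo m = applyUpTo suc m

-- x ∈ B_n : x is a permutation of {1,...,2n} (written as a word x_1 ... x_{2n})
-- with x_i + x_{2n+1-i} = 2n+1 for all i.
-- The i-th entry of reverse x is x_{2n+1-i}.
record InB (n : ℕ) (x : List ℕ) : Set where
  field
    isPerm    : x ↭ oneTo (2 * n)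
    symmetric : All (λ s → s ≡ suc (2 * n)) (zipWith _+_ x (reverse x))

Has312* : ℕ → List ℕ → Set
Has312* n x = ∃[ i ] ∃[ j ] ∃[ k ]
  (toℕ i < toℕ j × toℕ j < toℕ k ×
   lookup x j < lookup x k × lookup x k < lookup x i × suc n ≤ lookup x k)

InTam : ℕ → List ℕ → Set
InTam n x = InB n x × ¬ Has312* n x

-- Decomposition of a word into its maximal descending runs (consecutive
-- decreasing substrings), left to right.
descRuns : List ℕ → List (List ℕ)
descRuns [] = []
descRuns (a ∷ xs) with descRuns xs
... | [] = (a ∷ []) ∷ []
... | [] ∷ rs = (a ∷ []) ∷ rs
... | (b ∷ r) ∷ rs = if b <ᵇ a then (a ∷ b ∷ r) ∷ rs else (a ∷ []) ∷ (b ∷ r) ∷ rs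

rev : List ℕ → List ℕ
rev w = concat (map reverse (descRuns w))

half : ℕ → List ℕ → List ℕ
half n = filterᵇ (λ v → n <ᵇ v)

{-# OPTIONS --safe #-}
module Submission where

-- Restricting x to its large letters (those
-- above n) turns each maximal descending run into a descending, possibly
-- empty, word. Two consecutive nonempty ones cannot merge into one run of
-- half x: otherwise the last large letter c of the first exceeds the first
-- large letter d after it, while the letter u closing that run of x lies
-- below d (d follows u across the ascent, or a small letter above u does),
-- so c, u, d is a 312* pattern. Hence the runs of half x are the nonempty
-- restricted runs of x, and reversing each commutes with taking large letters.

open import Defs
open import Data.Nat using (ℕ; _<_; _≤_; _<ᵇ_; z<s; s<s)
open import Data.Nat.Properties using (<ᵇ⇒<; <⇒<ᵇ; _<?_; ≤⇒≯; ≮⇒≥; <-≤-trans; ≤-<-trans; ≤-trans; <⇒≤)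
open import Data.Bool using (true; false; if_then_else_; T)
open import Data.List using (List; []; _∷_; _++_; _∷ʳ_; reverse; map; concat; filter; lookup)
open import Data.List.Properties using (map-∘; map-cong; unfold-reverse; ++-identityʳ; filter-++; filter-accept; filter-reject; filter-none)
open import Data.List.Relation.Unary.All as All using (All; []; _∷_)
open import Data.List.Relation.Unary.Any using (index)
open import Data.List.Relation.Unary.Any.Properties using (lookup-index)
open import Data.List.Membership.Propositional using (_∈_)
open import Data.List.Membership.Propositional.Properties using (∈-filter⁻)
open import Data.Fin using (zero; suc)
open import Data.Product using (_×_; _,_; ∃₂)
open import Data.Empty using (⊥-elim)
open import Function using (_∘_)
open import Relation.Nullary using (¬_; Dec; yes; no)
open import Relation.Nullary.Decidable using (T?)
open import Relation.Unary using (Decidable)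
open import Relation.Binary.PropositionalEquality using (_≡_; refl; sym; trans; cong; subst; module ≡-Reasoning)
open ≡-Reasoning

dropEmpty : {A : Set} → List (List A) → List (List A)
dropEmpty [] = []
dropEmpty ([] ∷ xss) = dropEmpty xss
dropEmpty ((x ∷ xs) ∷ xss) = (x ∷ xs) ∷ dropEmpty xss

concat-map-reverse-dropEmpty : {A : Set} (xss : List (List A)) →
  concat (map reverse (dropEmpty xss)) ≡ concat (map reverse xss)
concat-map-reverse-dropEmpty [] = refl
concat-map-reverse-dropEmpty ([] ∷ xss) = concat-map-reverse-dropEmpty xss
concat-map-reverse-dropEmpty ((x ∷ xs) ∷ xss) = cong (reverse (x ∷ xs) ++_) (concat-map-reverse-dropEmpty xss)

module _ {A : Set} {P : A → Set} (P? : Decidable P) where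

  filter-reverse : (xs : List A) → filter P? (reverse xs) ≡ reverse (filter P? xs)
  filter-reverse [] = refl
  filter-reverse (x ∷ xs) = begin
    filter P? (reverse (x ∷ xs))                 ≡⟨ cong (filter P?) (unfold-reverse x xs) ⟩
    filter P? (reverse xs ∷ʳ x)                  ≡⟨ filter-++ P? (reverse xs) (x ∷ []) ⟩
    filter P? (reverse xs) ++ filter P? (x ∷ []) ≡⟨ cong (_++ filter P? (x ∷ [])) (filter-reverse xs) ⟩
    reverse (filter P? xs) ++ filter P? (x ∷ []) ≡⟨ snoc-filtered ⟩
    reverse (filter P? (x ∷ xs))                 ∎
    where
    snoc-filtered : reverse (filter P? xs) ++ filter P? (x ∷ []) ≡ reverse (filter P? (x ∷ xs))
    snoc-filtered with P? x
    ... | yes _ = sym (unfold-reverse x (filter P? xs))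
    ... | no _  = ++-identityʳ (reverse (filter P? xs))

  filter-concat : (xss : List (List A)) → filter P? (concat xss) ≡ concat (map (filter P?) xss)
  filter-concat [] = refl
  filter-concat (xs ∷ xss) = trans (filter-++ P? xs (concat xss)) (cong (filter P? xs ++_) (filter-concat xss))

  filter-concat-map-reverse : (xss : List (List A)) →
    filter P? (concat (map reverse xss)) ≡ concat (map reverse (dropEmpty (map (filter P?) xss)))
  filter-concat-map-reverse xss = begin
    filter P? (concat (map reverse xss))                    ≡⟨ filter-concat (map reverse xss) ⟩
    concat (map (filter P?) (map reverse xss))              ≡⟨ cong concat (map-∘ xss) ⟨
    concat (map (filter P? ∘ reverse) xss)                  ≡⟨ cong concat (map-cong filter-reverse xss) ⟩
    concat (map (reverse ∘ filter P?) xss)                  ≡⟨ cong concat (map-∘ xss) ⟩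
    concat (map reverse (map (filter P?) xss))              ≡⟨ concat-map-reverse-dropEmpty (map (filter P?) xss) ⟨
    concat (map reverse (dropEmpty (map (filter P?) xss)))  ∎

consRuns : ℕ → List (List ℕ) → List (List ℕ)
consRuns a [] = (a ∷ []) ∷ []
consRuns a ([] ∷ rs) = (a ∷ []) ∷ rs
consRuns a ((b ∷ r) ∷ rs) = if b <ᵇ a then (a ∷ b ∷ r) ∷ rs else (a ∷ []) ∷ (b ∷ r) ∷ rs

descRuns-∷ : (a : ℕ) (w : List ℕ) → descRuns (a ∷ w) ≡ consRuns a (descRuns w)
descRuns-∷ a w with descRuns w
... | [] = refl
... | [] ∷ rs = refl
... | (b ∷ r) ∷ rs = refl

consRuns-< : {a b : ℕ} {r : List ℕ} {rs : List (List ℕ)} → b < a →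
  consRuns a ((b ∷ r) ∷ rs) ≡ (a ∷ b ∷ r) ∷ rs
consRuns-< {a} {b} b<a with b <ᵇ a | <⇒<ᵇ b<a
... | true | _ = refl

consRuns-≮ : {a b : ℕ} {r : List ℕ} {rs : List (List ℕ)} → ¬ b < a →
  consRuns a ((b ∷ r) ∷ rs) ≡ (a ∷ []) ∷ (b ∷ r) ∷ rs
consRuns-≮ {a} {b} b≮a with b <ᵇ a | <ᵇ⇒< b a
... | true  | b<a = ⊥-elim (b≮a (b<a _))
... | false | _   = refl

descRuns-firstRun : (b : ℕ) (t : List ℕ) →
  ∃₂ λ r rs → descRuns (b ∷ t) ≡ (b ∷ r) ∷ rs × All (_≤ b) r
descRuns-firstRun b [] = [] , [] , refl , []
descRuns-firstRun b (c ∷ t) with descRuns-firstRun c t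
... | r , rs , eq , r≤c = extend (c <? b)
  where
  runs : descRuns (b ∷ c ∷ t) ≡ consRuns b ((c ∷ r) ∷ rs)
  runs = trans (descRuns-∷ b (c ∷ t)) (cong (consRuns b) eq)
  extend : Dec (c < b) → ∃₂ λ r′ rs′ → descRuns (b ∷ c ∷ t) ≡ (b ∷ r′) ∷ rs′ × All (_≤ b) r′
  extend (yes c<b) = c ∷ r , rs , trans runs (consRuns-< c<b) , <⇒≤ c<b ∷ All.map (λ v≤c → ≤-trans v≤c (<⇒≤ c<b)) r≤c
  extend (no c≮b)  = [] , (c ∷ r) ∷ rs , trans runs (consRuns-≮ c≮b) , []

descRuns-∷-≮ : {a b : ℕ} (t : List ℕ) → ¬ b < a → descRuns (a ∷ b ∷ t) ≡ (a ∷ []) ∷ descRuns (b ∷ t)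
descRuns-∷-≮ {a} {b} t b≮a with descRuns-firstRun b t
... | r , rs , eq , _ = begin
  descRuns (a ∷ b ∷ t)          ≡⟨ descRuns-∷ a (b ∷ t) ⟩
  consRuns a (descRuns (b ∷ t)) ≡⟨ cong (consRuns a) eq ⟩
  consRuns a ((b ∷ r) ∷ rs)     ≡⟨ consRuns-≮ b≮a ⟩
  (a ∷ []) ∷ (b ∷ r) ∷ rs       ≡⟨ cong ((a ∷ []) ∷_) eq ⟨
  (a ∷ []) ∷ descRuns (b ∷ t)   ∎

descRuns-∷-≤ : {a : ℕ} {v : List ℕ} → All (a ≤_) v → descRuns (a ∷ v) ≡ (a ∷ []) ∷ descRuns v
descRuns-∷-≤ [] = refl
descRuns-∷-≤ {v = b ∷ t} (a≤b ∷ _) = descRuns-∷-≮ t (≤⇒≯ a≤b)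

above? : (n : ℕ) → Decidable (λ v → T (n <ᵇ v))
above? n = T? ∘ (n <ᵇ_)

half-accept : {n a : ℕ} (xs : List ℕ) → n < a → half n (a ∷ xs) ≡ a ∷ half n xs
half-accept {n} {a} xs n<a = filter-accept (above? n) {a} {xs} (<⇒<ᵇ n<a)

half-reject : {n a : ℕ} (xs : List ℕ) → a ≤ n → half n (a ∷ xs) ≡ half n xs
half-reject {n} {a} xs a≤n = filter-reject (above? n) {a} {xs} (≤⇒≯ a≤n ∘ <ᵇ⇒< n a)

half-≤ : {n b : ℕ} {r : List ℕ} → All (_≤ b) r → b ≤ n → half n r ≡ []
half-≤ {n} r≤b b≤n = filter-none (above? n) (All.map (λ {v} v≤b → ≤⇒≯ (≤-trans v≤b b≤n) ∘ <ᵇ⇒< n v) r≤b)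

halfRuns : ℕ → List (List ℕ) → List (List ℕ)
halfRuns n rs = dropEmpty (map (half n) rs)

halfRuns-∷ : {n : ℕ} (r : List ℕ) {r′ : List ℕ} (rs : List (List ℕ)) → half n r ≡ r′ →
  halfRuns n (r ∷ rs) ≡ dropEmpty (r′ ∷ map (half n) rs)
halfRuns-∷ {n} _ rs eq = cong (λ r′ → dropEmpty (r′ ∷ map (half n) rs)) eq

halfRuns-consRuns-≤ : {n a : ℕ} → a ≤ n → (rs : List (List ℕ)) → halfRuns n (consRuns a rs) ≡ halfRuns n rs
halfRuns-consRuns-≤ {n} {a} a≤n = go
  where
  drop-a : ∀ r rs → halfRuns n ((a ∷ r) ∷ rs) ≡ halfRuns n (r ∷ rs)
  drop-a r rs = halfRuns-∷ (a ∷ r) rs (half-reject r a≤n)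
  go : ∀ rs → halfRuns n (consRuns a rs) ≡ halfRuns n rs
  go [] = drop-a [] []
  go ([] ∷ rs) = drop-a [] rs
  go ((b ∷ r) ∷ rs) with b <? a
  ... | yes b<a = trans (cong (halfRuns n) (consRuns-< b<a)) (drop-a (b ∷ r) rs)
  ... | no b≮a = trans (cong (halfRuns n) (consRuns-≮ b≮a)) (drop-a [] ((b ∷ r) ∷ rs))

avoids312*-tail : {n a : ℕ} {w : List ℕ} → ¬ Has312* n (a ∷ w) → ¬ Has312* n w
avoids312*-tail h (i , j , k , i<j , j<k , p) = h (suc i , suc j , suc k , s<s i<j , s<s j<k , p)

avoids312*-above-after-small : {n a b : ℕ} {t : List ℕ} → ¬ Has312* n (a ∷ b ∷ t) → b ≤ n →
  All (a ≤_) (half n t)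
avoids312*-above-after-small {n} {a} {b} {t} h b≤n = All.tabulate above-a
  where
  above-a : ∀ {c} → c ∈ half n t → a ≤ c
  above-a {c} c∈ with ∈-filter⁻ (above? n) {xs = t} c∈
  ... | c∈t , n<ᵇc = ≮⇒≥ λ c<a →
    h (zero , suc zero , suc (suc (index c∈t)) , z<s , s<s z<s ,
       subst (b <_) c≡ (≤-<-trans b≤n n<c) , subst (_< a) c≡ c<a , subst (n <_) c≡ n<c)
    where
    n<c : n < c
    n<c = <ᵇ⇒< n c n<ᵇc
    c≡ : c ≡ lookup t (index c∈t)
    c≡ = lookup-index c∈t

halfRuns-descRuns-above : {n a : ℕ} (w : List ℕ) → n < a → ¬ Has312* n (a ∷ w) →
  halfRuns n (descRuns w) ≡ descRuns (half n w) →
  halfRuns n (descRuns (a ∷ w)) ≡ descRuns (a ∷ half n w)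
halfRuns-descRuns-above {a = a} [] n<a _ _ = halfRuns-∷ (a ∷ []) [] (half-accept [] n<a)
halfRuns-descRuns-above {n} {a} (b ∷ t) n<a h ih with descRuns-firstRun b t
... | r , rs , eq , r≤b = cases (b <? a) (n <? b)
  where
  ih′ : halfRuns n ((b ∷ r) ∷ rs) ≡ descRuns (half n (b ∷ t))
  ih′ = trans (cong (halfRuns n) (sym eq)) ih

  runs : descRuns (a ∷ b ∷ t) ≡ consRuns a ((b ∷ r) ∷ rs)
  runs = trans (descRuns-∷ a (b ∷ t)) (cong (consRuns a) eq)

  cases : Dec (b < a) → Dec (n < b) → halfRuns n (descRuns (a ∷ b ∷ t)) ≡ descRuns (a ∷ half n (b ∷ t))
  cases (yes b<a) (yes n<b) = begin
    halfRuns n (descRuns (a ∷ b ∷ t))            ≡⟨ cong (halfRuns n) (trans runs (consRuns-< b<a)) ⟩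
    halfRuns n ((a ∷ b ∷ r) ∷ rs)                ≡⟨ halfRuns-∷ (a ∷ b ∷ r) rs (half-accept (b ∷ r) n<a) ⟩
    (a ∷ half n (b ∷ r)) ∷ halfRuns n rs         ≡⟨ cong (λ r′ → (a ∷ r′) ∷ halfRuns n rs) (half-accept r n<b) ⟩
    (a ∷ b ∷ half n r) ∷ halfRuns n rs           ≡⟨ consRuns-< b<a ⟨
    consRuns a ((b ∷ half n r) ∷ halfRuns n rs)  ≡⟨ cong (consRuns a) (halfRuns-∷ (b ∷ r) rs (half-accept r n<b)) ⟨
    consRuns a (halfRuns n ((b ∷ r) ∷ rs))       ≡⟨ cong (consRuns a) ih′ ⟩
    consRuns a (descRuns (half n (b ∷ t)))       ≡⟨ descRuns-∷ a (half n (b ∷ t)) ⟨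
    descRuns (a ∷ half n (b ∷ t))                ∎
  cases (yes b<a) (no n≮b) = begin
    halfRuns n (descRuns (a ∷ b ∷ t))            ≡⟨ cong (halfRuns n) (trans runs (consRuns-< b<a)) ⟩
    halfRuns n ((a ∷ b ∷ r) ∷ rs)                ≡⟨ halfRuns-∷ (a ∷ b ∷ r) rs (trans (half-accept (b ∷ r) n<a) (cong (a ∷_) b∷r-small)) ⟩
    (a ∷ []) ∷ halfRuns n rs                     ≡⟨ cong ((a ∷ []) ∷_) (halfRuns-∷ (b ∷ r) rs b∷r-small) ⟨
    (a ∷ []) ∷ halfRuns n ((b ∷ r) ∷ rs)         ≡⟨ cong ((a ∷ []) ∷_) ih′ ⟩
    (a ∷ []) ∷ descRuns (half n (b ∷ t))         ≡⟨ descRuns-∷-≤ t-above-a ⟨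
    descRuns (a ∷ half n (b ∷ t))                ∎
    where
    b≤n : b ≤ n
    b≤n = ≮⇒≥ n≮b
    b∷r-small : half n (b ∷ r) ≡ []
    b∷r-small = trans (half-reject r b≤n) (half-≤ r≤b b≤n)
    t-above-a : All (a ≤_) (half n (b ∷ t))
    t-above-a = subst (All (a ≤_)) (sym (half-reject t b≤n)) (avoids312*-above-after-small h b≤n)
  cases (no b≮a) _ = begin
    halfRuns n (descRuns (a ∷ b ∷ t))            ≡⟨ cong (halfRuns n) (trans runs (consRuns-≮ b≮a)) ⟩
    halfRuns n ((a ∷ []) ∷ (b ∷ r) ∷ rs)         ≡⟨ halfRuns-∷ (a ∷ []) ((b ∷ r) ∷ rs) (half-accept [] n<a) ⟩
    (a ∷ []) ∷ halfRuns n ((b ∷ r) ∷ rs)         ≡⟨ cong ((a ∷ []) ∷_) ih′ ⟩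
    (a ∷ []) ∷ descRuns (half n (b ∷ t))         ≡⟨ cong (λ v → (a ∷ []) ∷ descRuns v) (half-accept t n<b) ⟩
    (a ∷ []) ∷ descRuns (b ∷ half n t)           ≡⟨ descRuns-∷-≮ (half n t) b≮a ⟨
    descRuns (a ∷ b ∷ half n t)                  ≡⟨ cong (λ v → descRuns (a ∷ v)) (half-accept t n<b) ⟨
    descRuns (a ∷ half n (b ∷ t))                ∎
    where
    n<b : n < b
    n<b = <-≤-trans n<a (≮⇒≥ b≮a)

halfRuns-descRuns : {n : ℕ} (x : List ℕ) → ¬ Has312* n x → halfRuns n (descRuns x) ≡ descRuns (half n x)
halfRuns-descRuns [] _ = refl
halfRuns-descRuns {n} (a ∷ w) h with n <? a | halfRuns-descRuns w (avoids312*-tail h)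
... | yes n<a | ih = trans (halfRuns-descRuns-above w n<a h ih) (cong descRuns (sym (half-accept w n<a)))
... | no n≮a | ih = begin
  halfRuns n (descRuns (a ∷ w))         ≡⟨ cong (halfRuns n) (descRuns-∷ a w) ⟩
  halfRuns n (consRuns a (descRuns w))  ≡⟨ halfRuns-consRuns-≤ (≮⇒≥ n≮a) (descRuns w) ⟩
  halfRuns n (descRuns w)               ≡⟨ ih ⟩
  descRuns (half n w)                   ≡⟨ cong descRuns (half-reject w (≮⇒≥ n≮a)) ⟨
  descRuns (half n (a ∷ w))             ∎

mainTheorem12 : (n : ℕ) (x : List ℕ) → InTam n x →
    half n (rev x) ≡ rev (half n x)
mainTheorem12 n x (_ , avoids) = begin
  half n (rev x)                                  ≡⟨ filter-concat-map-reverse (above? n) (descRuns x) ⟩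
  concat (map reverse (halfRuns n (descRuns x)))  ≡⟨ cong (concat ∘ map reverse) (halfRuns-descRuns x avoids) ⟩
  rev (half n x)                                  ∎
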